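{- Let $(R,p)$ be one of $(\mathbb{Z}[\iota],3)$, $(\mathbb{Z}[\omega],4\omega+1)$, $(\mathbb{Z}[\omega],4\omega+3)$, let $\mathbb{F}=R/(p)$, and let $U$ be the image of $R^\times$ under $R\to\mathbb{F}$. Then every loop of length 4 in $\mathrm{BDA}_2^U(\mathbb{F})$ is nullhomotopic.
   Context: $\iota$ is a square root of $-1$ and $\omega$ a primitive cube root of unity. A $U$-vector in $\mathbb{F}^2$ is $[\vec v]=\{c\vec v:c\in U\}$, $\vec v\neq0$. A determinant-$U$ partial $U$-basis of $\mathbb{F}^n$ is a set $\{[\vec v_1],\dots,[\vec v_k]\}$ with the $\vec v_i$ linearly independent and $\det(\vec v_1,\dots,\vec v_n)\in U$ if $k=n$. An augmented determinant-$U$ partial $U$-basis is a set $\{[\vec v_0],\dots,[\vec v_k]\}$ reorderable so that $\{[\vec v_1],\dots,[\vec v_k]\}$ is a determinant-$U$ partial $U$-basis and $\vec v_0=\lambda\vec v_1+\nu\vec v_2$ with $\lambda,\nu\in U$. $\mathrm{BDA}_n^U(\mathbb{F})$ is the simplicial complex whose simplices are both kinds of sets (faces = subsets). A loop of length 4 is a closed edge path consisting of 4 edges. -}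

module Defs where

open import Level using (0ℓ)
open import Data.Integer as ℤ using (ℤ; +_)
open import Data.Product using (_×_; _,_; ∃; Σ)
open import Data.List using (List; []; _∷_; _++_)
open import Data.List.Relation.Unary.All using (All)
open import Data.List.Relation.Unary.Any using (Any)
open import Relation.Binary.PropositionalEquality using (_≡_)
open import Relation.Nullary using (¬_)

record RingOps : Set₁ where
  field
    Carrier : Set
    _+_ _*_ : Carrier → Carrier → Carrier
    -_      : Carrier → Carrier
    0# 1#   : Carrier

-- Gaussian integers ℤ[ι]:  (a , b) represents a + b ι,  ι² = -1.
ℤ[ι] : RingOps
ℤ[ι] = record
  { Carrier = ℤ × ℤ
  ; _+_ = λ { (a , b) (c , d) → (a ℤ.+ c , b ℤ.+ d) }
  ; _*_ = λ { (a , b) (c , d) → (a ℤ.* c ℤ.- b ℤ.* d , a ℤ.* d ℤ.+ b ℤ.* c) }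
  ; -_  = λ { (a , b) → (ℤ.- a , ℤ.- b) }
  ; 0#  = (+ 0 , + 0)
  ; 1#  = (+ 1 , + 0)
  }

-- Eisenstein integers ℤ[ω]:  (a , b) represents a + b ω,  ω² = -1 - ω.
ℤ[ω] : RingOps
ℤ[ω] = record
  { Carrier = ℤ × ℤ
  ; _+_ = λ { (a , b) (c , d) → (a ℤ.+ c , b ℤ.+ d) }
  ; _*_ = λ { (a , b) (c , d) →
              (a ℤ.* c ℤ.- b ℤ.* d , a ℤ.* d ℤ.+ b ℤ.* c ℤ.- b ℤ.* d) }
  ; -_  = λ { (a , b) → (ℤ.- a , ℤ.- b) }
  ; 0#  = (+ 0 , + 0)
  ; 1#  = (+ 1 , + 0)
  }

data Case : Set where
  gauss3 eis4ω+1 eis4ω+3 : Case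

ring : Case → RingOps
ring gauss3   = ℤ[ι]
ring eis4ω+1  = ℤ[ω]
ring eis4ω+3  = ℤ[ω]

prime : (c : Case) → RingOps.Carrier (ring c)
prime gauss3   = (+ 3 , + 0)
prime eis4ω+1  = (+ 1 , + 4)
prime eis4ω+3  = (+ 3 , + 4)

-- BDA₂^U(F) for F = R/(p), U = image of R^× in F.
-- Elements of F are represented by elements of R, with equality in F
-- being congruence modulo p.

module BDA (R : RingOps) (p : RingOps.Carrier R) where
  open RingOps R

  infix 4 _≈_ _≈v_ _∼_

  _-_ : Carrier → Carrier → Carrier
  x - y = x + (- y)

  _≈_ : Carrier → Carrier → Set
  x ≈ y = ∃ λ c → (x - y) ≡ (c * p)

  IsUnit : Carrier → Set
  IsUnit u = ∃ λ v → u * v ≡ 1#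

  InU : Carrier → Set
  InU x = ∃ λ u → IsUnit u × x ≈ u

  V2 : Set
  V2 = Carrier × Carrier

  _≈v_ : V2 → V2 → Set
  (a , b) ≈v (c , d) = (a ≈ c) × (b ≈ d)

  0v : V2
  0v = (0# , 0#)

  scale : Carrier → V2 → V2
  scale c (a , b) = (c * a , c * b)

  _+v_ : V2 → V2 → V2
  (a , b) +v (c , d) = (a + c , b + d)

  det : V2 → V2 → Carrier
  det (a , b) (c , d) = (a * d) - (b * c)

  LinIndep1 : V2 → Set
  LinIndep1 v = ∀ a → scale a v ≈v 0v → a ≈ 0#

  LinIndep2 : V2 → V2 → Set
  LinIndep2 v w = ∀ a b → (scale a v +v scale b w) ≈v 0v → (a ≈ 0#) × (b ≈ 0#)

  _∼_ : V2 → V2 → Set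
  w ∼ v = ∃ λ c → InU c × (w ≈v scale c v)

  -- Maximal generating sets of simplices (given by representatives):
  -- determinant-U partial U-bases (k = 0,1,2) and augmented ones.
  data Gen : List V2 → Set where
    gen0   : Gen []
    gen1   : ∀ v → ¬ (v ≈v 0v) → LinIndep1 v → Gen (v ∷ [])
    gen2   : ∀ v w → LinIndep2 v w → InU (det v w) → Gen (v ∷ w ∷ [])
    genAug : ∀ v₀ v₁ v₂ λ' ν → LinIndep2 v₁ v₂ → InU (det v₁ v₂) →
             InU λ' → InU ν → v₀ ≈v (scale λ' v₁ +v scale ν v₂) →
             Gen (v₀ ∷ v₁ ∷ v₂ ∷ [])

  IsSimplex : List V2 → Set
  IsSimplex S = ∃ λ g → Gen g × All (λ x → Any (x ∼_) g) S

  Edge : V2 → V2 → Set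
  Edge u v = IsSimplex (u ∷ v ∷ []) × ¬ (u ∼ v)

  -- Elementary moves of edge paths (vertex sequences), Spanier-style.
  data Move : List V2 → List V2 → Set where
    tri  : ∀ pre u v w post → IsSimplex (u ∷ v ∷ w ∷ []) →
           Move (pre ++ u ∷ v ∷ w ∷ post) (pre ++ u ∷ w ∷ post)
    stut : ∀ pre u post →
           Move (pre ++ u ∷ u ∷ post) (pre ++ u ∷ post)

  data Homotopic : List V2 → List V2 → Set where
    hrefl  : ∀ P → Homotopic P P
    hfwd   : ∀ {P Q} → Move P Q → Homotopic P Q
    hbwd   : ∀ {P Q} → Move Q P → Homotopic P Q
    htrans : ∀ {P Q S} → Homotopic P Q → Homotopic Q S → Homotopic P S

  Loops4Null : Set
  Loops4Null = ∀ x₀ x₁ x₂ x₃ →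
    Edge x₀ x₁ → Edge x₁ x₂ → Edge x₂ x₃ → Edge x₃ x₀ →
    Homotopic (x₀ ∷ x₁ ∷ x₂ ∷ x₃ ∷ x₀ ∷ []) (x₀ ∷ [])

{-# OPTIONS --safe #-}
module Submission where

-- Along a loop x₀x₁x₂x₃x₀ of BDA₂^U(𝔽) every edge has det(xᵢ, xᵢ₊₁) ∈ U, and three vectors with
-- pairwise determinants in U span a simplex (an augmented basis, by Cramer's rule). Split on the
-- diagonals D₀₂ = det(x₀, x₂) and D₁₃. If a diagonal vanishes, its endpoints are the same U-vector
-- and the square degenerates; if it lies in U, it cuts the square into two triangles. Otherwise
-- both diagonals are non-units. For each of the three pairs (R, p), U has index two in 𝔽^×, and
-- for a suitable unit κ the vector y = (1 + κ)(D₁₂x₀ − κD₀₁x₂) has determinant in U with every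
-- corner (with x₃ by the Plücker relation D₀₂D₁₃ = D₀₁D₂₃ − D₃₀D₁₂), so the square is a cone with
-- apex y. Once the units of ℤ[ι] and ℤ[ω] are known from their norms, these facts about U and κ
-- are checked by exhaustive computation in 𝔽 ≅ 𝔽₉ and 𝔽 ≅ 𝔽₁₃.

open import Level using (0ℓ)
open import Function using (_∘_)
open import Algebra.Bundles using (CommutativeRing)
open import Algebra.Core using (Op₁; Op₂)
open import Algebra.Definitions using (Associative; Commutative; LeftIdentity; _DistributesOverˡ_)
open import Algebra.Structures using (IsCommutativeRing; IsAbelianGroup)
open import Algebra.Consequences.Propositional using (comm∧idˡ⇒id; comm∧distrˡ⇒distrʳ)
open import Algebra.Solver.Ring.AlmostCommutativeRing
  using (AlmostCommutativeRing; fromCommutativeRing; _-Raw-AlmostCommutative⟶_; Induced-equivalence)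
open import Data.Empty using (⊥-elim)
open import Data.Fin as Fin using (Fin; toℕ)
import Data.Fin.Properties as Fin
open import Data.Integer as ℤ using (ℤ; +_; -[1+_]; ∣_∣)
import Data.Integer.DivMod as ℤ
import Data.Integer.Properties as ℤ
open import Data.Integer.Tactic.RingSolver using (solve-∀)
open import Data.List using (List; []; _∷_)
open import Data.List.Membership.Propositional using (_∈_)
open import Data.List.Relation.Unary.All as All using (All; []; _∷_)
open import Data.List.Relation.Unary.AllPairs using (AllPairs; []; _∷_)
open import Data.List.Relation.Unary.Any as Any using (Any; here; there)
open import Data.Maybe using (just; nothing)
open import Data.Nat as ℕ using (ℕ; zero; suc; z≤n; s≤s)
import Data.Nat.DivMod as ℕ
import Data.Nat.Properties as ℕ
open import Data.Product using (_×_; _,_; ∃; proj₁; proj₂)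
open import Data.Product.Properties using (≡-dec)
open import Data.Sum using (_⊎_; inj₁; inj₂)
open import Relation.Binary.Bundles using (Setoid)
open import Relation.Binary.Definitions using (DecidableEquality; WeaklyDecidable)
open import Relation.Binary.PropositionalEquality
  using (_≡_; refl; sym; trans; cong; cong₂; subst; isEquivalence; module ≡-Reasoning)
import Relation.Binary.Reasoning.Setoid as SetoidReasoning
open import Relation.Nullary using (¬_; Dec; yes; no; ¬?)
open import Relation.Nullary.Decidable using (map′; _×-dec_; _→-dec_; True; toWitness)
open import Relation.Unary using (Decidable)

open import Defs

record RingLaws (R : RingOps) : Set where
  open RingOps R
  field
    isCommutativeRing : IsCommutativeRing _≡_ _+_ _*_ -_ 0# 1#

  commutativeRing : CommutativeRing 0ℓ 0ℓ
  commutativeRing = record { isCommutativeRing = isCommutativeRing }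

  -- The canonical map ℤ → R, which lets the ring solver work with integer coefficients.
  field
    fromℤ : ℤ.+-*-rawRing -Raw-AlmostCommutative⟶ fromCommutativeRing commutativeRing

ℤ-coefficients≟ : {R : AlmostCommutativeRing 0ℓ 0ℓ} (φ : ℤ.+-*-rawRing -Raw-AlmostCommutative⟶ R) →
                  WeaklyDecidable (Induced-equivalence φ)
ℤ-coefficients≟ {R} _ i j with i ℤ.≟ j
... | yes refl = just (AlmostCommutativeRing.refl R)
... | no _     = nothing

module BDA-Properties (R : RingOps) (laws : RingLaws R) (p : RingOps.Carrier R) where
  open RingOps R using (Carrier)
  open RingLaws laws
  open CommutativeRing commutativeRing
    using (_+_; _*_; -_; _-_; 0#; 1#; *-comm; *-assoc; *-identityˡ; *-identityʳ; zeroˡ; zeroʳ;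
           +-identityʳ; -‿inverseʳ; distribˡ; distribʳ)
  open import Algebra.Properties.Ring (CommutativeRing.ring commutativeRing) using (-‿distribˡ-*; -1*x≈-x)
  open BDA R p hiding (_-_)
  open import Algebra.Solver.Ring
    ℤ.+-*-rawRing (fromCommutativeRing commutativeRing) fromℤ (ℤ-coefficients≟ fromℤ)
    using (solve; _:=_; _:+_; _:*_; :-_; _:-_; Polynomial)

  private
    Poly² : ℕ → Set
    Poly² n = Polynomial n × Polynomial n

    :det : ∀ {n} → Poly² n → Poly² n → Polynomial n
    :det (a , b) (c , d) = a :* d :- b :* c

    :scale : ∀ {n} → Polynomial n → Poly² n → Poly² n
    :scale c (a , b) = c :* a , c :* b

    _:+v_ : ∀ {n} → Poly² n → Poly² n → Poly² n
    (a , b) :+v (c , d) = a :+ c , b :+ d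

  det-swap : ∀ u v → det v u ≡ - det u v
  det-swap (a , b) (c , d) =
    solve 4 (λ a b c d → :det (c , d) (a , b) := :- :det (a , b) (c , d)) refl a b c d

  det-zeroˡ : ∀ v → det 0v v ≡ 0#
  det-zeroˡ (a , b) = trans (cong₂ _-_ (zeroˡ b) (zeroˡ a)) (-‿inverseʳ 0#)

  det-scale : ∀ c c′ u v → det (scale c u) (scale c′ v) ≡ (c * c′) * det u v
  det-scale c c′ (a , b) (d , e) =
    solve 6 (λ c c′ a b d e → :det (:scale c (a , b)) (:scale c′ (d , e))
                              := (c :* c′) :* :det (a , b) (d , e))
      refl c c′ a b d e

  det-combinationˡ : ∀ a b v w → det (scale a v +v scale b w) v ≡ det w v * b
  det-combinationˡ a b (c , d) (e , f) =
    solve 6 (λ a b c d e f → :det (:scale a (c , d) :+v :scale b (e , f)) (c , d)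
                             := :det (e , f) (c , d) :* b)
      refl a b c d e f

  det-combinationʳ : ∀ a b v w → det (scale a v +v scale b w) w ≡ det v w * a
  det-combinationʳ a b (c , d) (e , f) =
    solve 6 (λ a b c d e f → :det (:scale a (c , d) :+v :scale b (e , f)) (e , f)
                             := :det (c , d) (e , f) :* a)
      refl a b c d e f

  cramer : ∀ v w z → scale (det v w) z ≡ scale (det z w) v +v scale (det v z) w
  cramer (a , b) (c , d) (e , f) = cong₂ _,_
    (solve 6 (λ a b c d e f → :det (a , b) (c , d) :* e
                              := :det (e , f) (c , d) :* a :+ :det (a , b) (e , f) :* c)
       refl a b c d e f)
    (solve 6 (λ a b c d e f → :det (a , b) (c , d) :* f
                              := :det (e , f) (c , d) :* b :+ :det (a , b) (e , f) :* d)
       refl a b c d e f)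

  plücker : ∀ x₀ x₁ x₂ x₃ → det x₀ x₂ * det x₁ x₃ ≡ det x₀ x₁ * det x₂ x₃ - det x₃ x₀ * det x₁ x₂
  plücker (a , b) (c , d) (e , f) (g , h) =
    solve 8 (λ a b c d e f g h →
      :det (a , b) (e , f) :* :det (c , d) (g , h)
        := :det (a , b) (c , d) :* :det (e , f) (g , h) :- :det (g , h) (a , b) :* :det (c , d) (e , f))
      refl a b c d e f g h

  scale-assoc : ∀ c c′ u → scale c (scale c′ u) ≡ scale (c * c′) u
  scale-assoc c c′ (a , b) = cong₂ _,_ (sym (*-assoc c c′ a)) (sym (*-assoc c c′ b))

  scale-identity : ∀ u → scale 1# u ≡ u
  scale-identity (a , b) = cong₂ _,_ (*-identityˡ a) (*-identityˡ b)

  scale-distrib : ∀ d s t v w → scale d (scale s v +v scale t w) ≡ scale (d * s) v +v scale (d * t) w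
  scale-distrib d s t (a , b) (c , e) = cong₂ _,_
    (solve 5 (λ d s t a c → d :* (s :* a :+ t :* c) := d :* s :* a :+ d :* t :* c) refl d s t a c)
    (solve 5 (λ d s t b e → d :* (s :* b :+ t :* e) := d :* s :* b :+ d :* t :* e) refl d s t b e)

  -- Congruence modulo p

  -- x ≈ y unfolds to InIdeal (x - y).
  InIdeal : Carrier → Set
  InIdeal z = ∃ λ c → z ≡ c * p

  ideal-0 : InIdeal 0#
  ideal-0 = 0# , sym (zeroˡ p)

  ideal-+ : ∀ {a b} → InIdeal a → InIdeal b → InIdeal (a + b)
  ideal-+ (c , refl) (d , refl) = c + d , sym (distribʳ p c d)

  ideal-neg : ∀ {a} → InIdeal a → InIdeal (- a)
  ideal-neg (c , refl) = - c , -‿distribˡ-* c p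

  ideal-* : ∀ c {a} → InIdeal a → InIdeal (c * a)
  ideal-* c (d , refl) = c * d , sym (*-assoc c d p)

  ideal-resp : ∀ {a b} → a ≡ b → InIdeal a → InIdeal b
  ideal-resp refl a∈I = a∈I

  ≈-reflexive : ∀ {x y} → x ≡ y → x ≈ y
  ≈-reflexive {x} refl = ideal-resp (sym (-‿inverseʳ x)) ideal-0

  ≈-refl : ∀ {x} → x ≈ x
  ≈-refl = ≈-reflexive refl

  ≈-sym : ∀ {x y} → x ≈ y → y ≈ x
  ≈-sym {x} {y} = ideal-resp (solve 2 (λ x y → :- (x :- y) := y :- x) refl x y) ∘ ideal-neg

  ≈-trans : ∀ {x y z} → x ≈ y → y ≈ z → x ≈ z
  ≈-trans {x} {y} {z} x≈y y≈z =
    ideal-resp (solve 3 (λ x y z → (x :- y) :+ (y :- z) := x :- z) refl x y z) (ideal-+ x≈y y≈z)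

  +-cong : ∀ {x y u v} → x ≈ y → u ≈ v → x + u ≈ y + v
  +-cong {x} {y} {u} {v} x≈y u≈v =
    ideal-resp (solve 4 (λ x y u v → (x :- y) :+ (u :- v) := (x :+ u) :- (y :+ v)) refl x y u v)
      (ideal-+ x≈y u≈v)

  *-cong : ∀ {x y u v} → x ≈ y → u ≈ v → x * u ≈ y * v
  *-cong {x} {y} {u} {v} x≈y u≈v =
    ideal-resp (solve 4 (λ x y u v → u :* (x :- y) :+ y :* (u :- v) := x :* u :- y :* v) refl x y u v)
      (ideal-+ (ideal-* u x≈y) (ideal-* y u≈v))

  -‿cong : ∀ {x y} → x ≈ y → - x ≈ - y
  -‿cong {x} {y} = ideal-resp (solve 2 (λ x y → :- (x :- y) := :- x :- :- y) refl x y) ∘ ideal-neg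

  ≈-setoid : Setoid 0ℓ 0ℓ
  ≈-setoid = record
    { Carrier = Carrier ; _≈_ = _≈_
    ; isEquivalence = record { refl = ≈-refl ; sym = ≈-sym ; trans = ≈-trans } }

  module ≈-Reasoning = SetoidReasoning ≈-setoid

  IsUnit-1 : IsUnit 1#
  IsUnit-1 = 1# , *-identityˡ 1#

  IsUnit-* : ∀ {u w} → IsUnit u → IsUnit w → IsUnit (u * w)
  IsUnit-* {u} {w} (u′ , uu′≡1) (w′ , ww′≡1) = u′ * w′ , (begin
    (u * w) * (u′ * w′) ≡⟨ solve 4 (λ u w u′ w′ → (u :* w) :* (u′ :* w′) := (u :* u′) :* (w :* w′))
                                   refl u w u′ w′ ⟩
    (u * u′) * (w * w′) ≡⟨ cong₂ _*_ uu′≡1 ww′≡1 ⟩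
    1# * 1#             ≡⟨ *-identityˡ 1# ⟩
    1#                  ∎)
    where open ≡-Reasoning

  IsUnit-neg : ∀ {u} → IsUnit u → IsUnit (- u)
  IsUnit-neg {u} (u′ , uu′≡1) = - u′ , trans (solve 2 (λ u u′ → :- u :* :- u′ := u :* u′) refl u u′) uu′≡1

  InU-resp : ∀ {x y} → x ≈ y → InU x → InU y
  InU-resp x≈y (u , u-unit , x≈u) = u , u-unit , ≈-trans (≈-sym x≈y) x≈u

  InU-1 : InU 1#
  InU-1 = 1# , IsUnit-1 , ≈-refl

  InU-* : ∀ {x y} → InU x → InU y → InU (x * y)
  InU-* (u , u-unit , x≈u) (w , w-unit , y≈w) = u * w , IsUnit-* u-unit w-unit , *-cong x≈u y≈w

  InU-neg : ∀ {x} → InU x → InU (- x)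
  InU-neg (u , u-unit , x≈u) = - u , IsUnit-neg u-unit , -‿cong x≈u

  InU-inverse : ∀ {x} → InU x → ∃ λ x′ → InU x′ × x′ * x ≈ 1#
  InU-inverse (u , (u′ , uu′≡1) , x≈u) =
    u′ , (u′ , (u , u′u≡1) , ≈-refl) , ≈-trans (*-cong ≈-refl x≈u) (≈-reflexive u′u≡1)
    where
    u′u≡1 = trans (*-comm u′ u) uu′≡1

  undo-* : ∀ {x′ x} → x′ * x ≈ 1# → ∀ a → a ≈ x′ * (x * a)
  undo-* {x′} {x} x′x≈1 a = begin
    a            ≡⟨ *-identityˡ a ⟨
    1# * a       ≈⟨ *-cong x′x≈1 ≈-refl ⟨
    (x′ * x) * a ≡⟨ *-assoc x′ x a ⟩
    x′ * (x * a) ∎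
    where open ≈-Reasoning

  InU-cancelˡ : ∀ {d a} → InU d → d * a ≈ 0# → a ≈ 0#
  InU-cancelˡ {a = a} d∈U da≈0 with InU-inverse d∈U
  ... | d′ , _ , d′d≈1 = ≈-trans (undo-* d′d≈1 a) (≈-trans (*-cong ≈-refl da≈0) (≈-reflexive (zeroʳ d′)))

  NonUnit : Carrier → Set
  NonUnit x = ¬ x ≈ 0# × ¬ InU x

  NonUnit-resp : ∀ {x y} → x ≈ y → NonUnit x → NonUnit y
  NonUnit-resp x≈y (x≉0 , x∉U) = x≉0 ∘ ≈-trans x≈y , x∉U ∘ InU-resp (≈-sym x≈y)

  InU-*-NonUnit : ∀ {u x} → InU u → NonUnit x → NonUnit (u * x)
  InU-*-NonUnit {x = x} u∈U (x≉0 , x∉U) with InU-inverse u∈U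
  ... | u′ , u′∈U , u′u≈1 = x≉0 ∘ InU-cancelˡ u∈U , x∉U ∘ InU-resp (≈-sym (undo-* u′u≈1 x)) ∘ InU-* u′∈U

  NonUnit-neg : ∀ {x} → NonUnit x → NonUnit (- x)
  NonUnit-neg {x} = NonUnit-resp (≈-reflexive (-1*x≈-x x)) ∘ InU-*-NonUnit (InU-neg InU-1)

  ≈v-refl : ∀ {u} → u ≈v u
  ≈v-refl = ≈-refl , ≈-refl

  ≈v-reflexive : ∀ {u v} → u ≡ v → u ≈v v
  ≈v-reflexive refl = ≈v-refl

  ≈v-sym : ∀ {u v} → u ≈v v → v ≈v u
  ≈v-sym (a≈c , b≈d) = ≈-sym a≈c , ≈-sym b≈d

  ≈v-trans : ∀ {u v w} → u ≈v v → v ≈v w → u ≈v w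
  ≈v-trans (a≈c , b≈d) (c≈e , d≈f) = ≈-trans a≈c c≈e , ≈-trans b≈d d≈f

  ≈v-setoid : Setoid 0ℓ 0ℓ
  ≈v-setoid = record
    { Carrier = V2 ; _≈_ = _≈v_
    ; isEquivalence = record { refl = ≈v-refl ; sym = ≈v-sym ; trans = ≈v-trans } }

  scale-cong : ∀ {c c′ u v} → c ≈ c′ → u ≈v v → scale c u ≈v scale c′ v
  scale-cong c≈c′ (a≈c , b≈d) = *-cong c≈c′ a≈c , *-cong c≈c′ b≈d

  det-cong : ∀ {u u′ v v′} → u ≈v u′ → v ≈v v′ → det u v ≈ det u′ v′
  det-cong (a≈a′ , b≈b′) (c≈c′ , d≈d′) = +-cong (*-cong a≈a′ d≈d′) (-‿cong (*-cong b≈b′ c≈c′))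

  ∼-refl : ∀ {u} → u ∼ u
  ∼-refl {u} = 1# , InU-1 , ≈v-reflexive (sym (scale-identity u))

  ∼-trans : ∀ {u v w} → u ∼ v → v ∼ w → u ∼ w
  ∼-trans {w = w} (c , c∈U , u≈cv) (c′ , c′∈U , v≈c′w) =
    c * c′ , InU-* c∈U c′∈U ,
    ≈v-trans u≈cv (≈v-trans (scale-cong ≈-refl v≈c′w) (≈v-reflexive (scale-assoc c c′ w)))

  ∼-sym : ∀ {u v} → u ∼ v → v ∼ u
  ∼-sym {u} {v} (c , c∈U , u≈cv) with InU-inverse c∈U
  ... | c′ , c′∈U , c′c≈1 = c′ , c′∈U , ≈v-sym (begin
    scale c′ u           ≈⟨ scale-cong ≈-refl u≈cv ⟩
    scale c′ (scale c v) ≡⟨ scale-assoc c′ c v ⟩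
    scale (c′ * c) v     ≈⟨ scale-cong c′c≈1 ≈v-refl ⟩
    scale 1# v           ≡⟨ scale-identity v ⟩
    v                    ∎)
    where open SetoidReasoning ≈v-setoid

  +v-vanishingʳ : ∀ {t} s v w → t ≈ 0# → scale s v +v scale t w ≈v scale s v
  +v-vanishingʳ {t} s (a , b) (c , d) t≈0 = drop a c , drop b d
    where
    drop : ∀ x y → s * x + t * y ≈ s * x
    drop x y = begin
      s * x + t * y  ≈⟨ +-cong ≈-refl (*-cong t≈0 ≈-refl) ⟩
      s * x + 0# * y ≡⟨ cong (_+_ (s * x)) (zeroˡ y) ⟩
      s * x + 0#     ≡⟨ +-identityʳ (s * x) ⟩
      s * x          ∎
      where open ≈-Reasoning

  Unimodular : V2 → V2 → Set
  Unimodular u v = InU (det u v)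

  unimodular-sym : ∀ {u v} → Unimodular u v → Unimodular v u
  unimodular-sym {u} {v} = InU-resp (≈-reflexive (sym (det-swap u v))) ∘ InU-neg

  unimodular-resp : ∀ {x y u v} → x ∼ u → y ∼ v → Unimodular u v → Unimodular x y
  unimodular-resp {u = u} {v} (c , c∈U , x≈cu) (c′ , c′∈U , y≈c′v) =
    InU-resp (≈-sym (≈-trans (det-cong x≈cu y≈c′v) (≈-reflexive (det-scale c c′ u v))))
      ∘ InU-* (InU-* c∈U c′∈U)

  unimodular⇒linIndep : ∀ {v w} → Unimodular v w → LinIndep2 v w
  unimodular⇒linIndep {v} {w} vw a b av+bw≈0 =
    InU-cancelˡ vw (vanishes w (det-combinationʳ a b v w)) ,
    InU-cancelˡ (unimodular-sym vw) (vanishes v (det-combinationˡ a b v w))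
    where
    vanishes : ∀ z {t} → det (scale a v +v scale b w) z ≡ t → t ≈ 0#
    vanishes z refl = ≈-trans (det-cong av+bw≈0 ≈v-refl) (≈-reflexive (det-zeroˡ z))

  cramer-solution : ∀ {v w d′} z → d′ * det v w ≈ 1# → z ≈v scale (d′ * det z w) v +v scale (d′ * det v z) w
  cramer-solution {v} {w} {d′} z d′D≈1 = begin
    z                                                 ≡⟨ scale-identity z ⟨
    scale 1# z                                        ≈⟨ scale-cong d′D≈1 ≈v-refl ⟨
    scale (d′ * det v w) z                            ≡⟨ scale-assoc d′ (det v w) z ⟨
    scale d′ (scale (det v w) z)                      ≡⟨ cong (scale d′) (cramer v w z) ⟩
    scale d′ (scale (det z w) v +v scale (det v z) w) ≡⟨ scale-distrib d′ (det z w) (det v z) v w ⟩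
    scale (d′ * det z w) v +v scale (d′ * det v z) w  ∎
    where open SetoidReasoning ≈v-setoid

  det≈0⇒∼ : ∀ {v w z} → Unimodular v w → det v z ≈ 0# → Unimodular z w → z ∼ v
  det≈0⇒∼ {v} {w} {z} vw vz≈0 zw with InU-inverse vw
  ... | d′ , d′∈U , d′D≈1 =
    d′ * det z w , InU-* d′∈U zw ,
    ≈v-trans (cramer-solution z d′D≈1)
             (+v-vanishingʳ _ v w (≈-trans (*-cong ≈-refl vz≈0) (≈-reflexive (zeroʳ d′))))

  infix 4 _⊑_
  _⊑_ : List V2 → List V2 → Set
  S ⊑ T = All (λ x → Any (x ∼_) T) S

  ∈∼-trans : ∀ {x T U} → Any (x ∼_) T → T ⊑ U → Any (x ∼_) U
  ∈∼-trans (here x∼t)  (t∈U ∷ _)  = Any.map (∼-trans x∼t) t∈U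
  ∈∼-trans (there x∈T) (_ ∷ T⊑U) = ∈∼-trans x∈T T⊑U

  simplex-mono : ∀ {S T} → S ⊑ T → IsSimplex T → IsSimplex S
  simplex-mono S⊑T (g , G , T⊑g) = g , G , All.map (λ x∈T → ∈∼-trans x∈T T⊑g) S⊑T

  pair-simplex : ∀ {a b} → Unimodular a b → IsSimplex (a ∷ b ∷ [])
  pair-simplex {a} {b} ab =
    a ∷ b ∷ [] , gen2 a b (unimodular⇒linIndep ab) ab , here ∼-refl ∷ there (here ∼-refl) ∷ []

  edge-simplex : ∀ {u v} → Unimodular u v → IsSimplex (u ∷ v ∷ u ∷ [])
  edge-simplex = simplex-mono (here ∼-refl ∷ there (here ∼-refl) ∷ here ∼-refl ∷ []) ∘ pair-simplex

  triangle-simplex : ∀ {a b c} → Unimodular a b → Unimodular a c → Unimodular b c → IsSimplex (a ∷ b ∷ c ∷ [])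
  triangle-simplex {a} {b} {c} ab ac bc with InU-inverse ab
  ... | d′ , d′∈U , d′D≈1 =
    c ∷ a ∷ b ∷ [] ,
    genAug c a b _ _ (unimodular⇒linIndep ab) ab
      (InU-* d′∈U (unimodular-sym bc)) (InU-* d′∈U ac) (cramer-solution c d′D≈1) ,
    there (here ∼-refl) ∷ there (there (here ∼-refl)) ∷ here ∼-refl ∷ []

  gen-unimodular : ∀ {g} → Gen g → AllPairs Unimodular g
  gen-unimodular gen0             = []
  gen-unimodular (gen1 _ _ _)     = [] ∷ []
  gen-unimodular (gen2 _ _ _ vw)  = (vw ∷ []) ∷ [] ∷ []
  gen-unimodular (genAug v₀ v₁ v₂ a b _ v₁v₂ a∈U b∈U v₀≈av₁+bv₂) =
    (via v₁ (det-combinationˡ a b v₁ v₂) (InU-* (unimodular-sym v₁v₂) b∈U) ∷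
     via v₂ (det-combinationʳ a b v₁ v₂) (InU-* v₁v₂ a∈U) ∷ []) ∷ (v₁v₂ ∷ []) ∷ [] ∷ []
    where
    via : ∀ z {t} → det (scale a v₁ +v scale b v₂) z ≡ t → InU t → Unimodular v₀ z
    via z refl = InU-resp (≈-sym (det-cong v₀≈av₁+bv₂ ≈v-refl))

  unimodular-any : ∀ {x y g gs} → x ∼ g → All (Unimodular g) gs → Any (y ∼_) gs → Unimodular x y
  unimodular-any x∼g (gh ∷ _)  (here y∼h)   = unimodular-resp x∼g y∼h gh
  unimodular-any x∼g (_ ∷ ghs) (there y∈gs) = unimodular-any x∼g ghs y∈gs

  unimodular-members : ∀ {g x y} → AllPairs Unimodular g → Any (x ∼_) g → Any (y ∼_) g → ¬ x ∼ y →
                       Unimodular x y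
  unimodular-members _           (here x∼g)   (here y∼g)   x≁y = ⊥-elim (x≁y (∼-trans x∼g (∼-sym y∼g)))
  unimodular-members (ghs ∷ _)   (here x∼g)   (there y∈gs) _   = unimodular-any x∼g ghs y∈gs
  unimodular-members (ghs ∷ _)   (there x∈gs) (here y∼g)   _   = unimodular-sym (unimodular-any y∼g ghs x∈gs)
  unimodular-members (_ ∷ pairs) (there x∈gs) (there y∈gs) x≁y = unimodular-members pairs x∈gs y∈gs x≁y

  edge-unimodular : ∀ {x y} → Edge x y → Unimodular x y
  edge-unimodular ((_ , G , x∈g ∷ y∈g ∷ []) , x≁y) = unimodular-members (gen-unimodular G) x∈g y∈g x≁y

  -- Filling squares

  infixr 5 _◅_
  _◅_ : ∀ {P Q S} → Move P Q → Homotopic Q S → Homotopic P S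
  m ◅ h = htrans (hfwd m) h

  module _ {x₀ x₁ x₂ x₃ : V2} where

    square-split₀₂ : IsSimplex (x₀ ∷ x₁ ∷ x₂ ∷ []) → IsSimplex (x₀ ∷ x₂ ∷ x₃ ∷ []) → Unimodular x₀ x₃ →
                     Homotopic (x₀ ∷ x₁ ∷ x₂ ∷ x₃ ∷ x₀ ∷ []) (x₀ ∷ [])
    square-split₀₂ σ₀₁₂ σ₀₂₃ x₀x₃ =
      tri [] x₀ x₁ x₂ (x₃ ∷ x₀ ∷ []) σ₀₁₂ ◅
      tri [] x₀ x₂ x₃ (x₀ ∷ []) σ₀₂₃ ◅
      tri [] x₀ x₃ x₀ [] (edge-simplex x₀x₃) ◅
      hfwd (stut [] x₀ [])

    square-split₁₃ : IsSimplex (x₁ ∷ x₂ ∷ x₃ ∷ []) → IsSimplex (x₁ ∷ x₃ ∷ x₀ ∷ []) → Unimodular x₀ x₁ →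
                     Homotopic (x₀ ∷ x₁ ∷ x₂ ∷ x₃ ∷ x₀ ∷ []) (x₀ ∷ [])
    square-split₁₃ σ₁₂₃ σ₁₃₀ x₀x₁ =
      tri (x₀ ∷ []) x₁ x₂ x₃ (x₀ ∷ []) σ₁₂₃ ◅
      tri (x₀ ∷ []) x₁ x₃ x₀ [] σ₁₃₀ ◅
      tri [] x₀ x₁ x₀ [] (edge-simplex x₀x₁) ◅
      hfwd (stut [] x₀ [])

    square-cone : Unimodular x₀ x₁ → Unimodular x₁ x₂ → Unimodular x₂ x₃ → Unimodular x₃ x₀ →
                  (∃ λ y → Unimodular y x₀ × Unimodular y x₁ × Unimodular y x₂ × Unimodular y x₃) →
                  Homotopic (x₀ ∷ x₁ ∷ x₂ ∷ x₃ ∷ x₀ ∷ []) (x₀ ∷ [])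
    square-cone x₀x₁ x₁x₂ x₂x₃ x₃x₀ (y , yx₀ , yx₁ , yx₂ , yx₃) =
      htrans (hbwd (tri [] x₀ y x₁ (x₂ ∷ x₃ ∷ x₀ ∷ []) (triangle-simplex x₀y x₀x₁ yx₁))) (
        tri (x₀ ∷ []) y x₁ x₂ (x₃ ∷ x₀ ∷ []) (triangle-simplex yx₁ yx₂ x₁x₂) ◅
        tri (x₀ ∷ []) y x₂ x₃ (x₀ ∷ []) (triangle-simplex yx₂ yx₃ x₂x₃) ◅
        tri (x₀ ∷ []) y x₃ x₀ [] (triangle-simplex yx₃ yx₀ x₃x₀) ◅
        tri [] x₀ y x₀ [] (edge-simplex x₀y) ◅
        hfwd (stut [] x₀ []))
      where
      x₀y = unimodular-sym yx₀

  apex : Carrier → Carrier → V2 → V2 → V2 → V2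
  apex n κ x₀ x₁ x₂ = scale n (scale (det x₁ x₂) x₀ +v scale (- (κ * det x₀ x₁)) x₂)

  private
    :apex : ∀ {m} → Polynomial m → Polynomial m → Poly² m → Poly² m → Poly² m → Poly² m
    :apex n κ x₀ x₁ x₂ = :scale n (:scale (:det x₁ x₂) x₀ :+v :scale (:- (κ :* :det x₀ x₁)) x₂)

  det-apex₀ : ∀ n κ x₀ x₁ x₂ → det (apex n κ x₀ x₁ x₂) x₀ ≡ n * ((κ * det x₀ x₁) * det x₀ x₂)
  det-apex₀ n κ (a , b) (c , d) (e , f) =
    solve 8 (λ n κ a b c d e f → :det (:apex n κ (a , b) (c , d) (e , f)) (a , b)
                                 := n :* ((κ :* :det (a , b) (c , d)) :* :det (a , b) (e , f)))
      refl n κ a b c d e f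

  det-apex₁ : ∀ n κ x₀ x₁ x₂ →
              det (apex n κ x₀ x₁ x₂) x₁ ≡ n * (det x₀ x₁ * det x₁ x₂ + (det x₀ x₁ * det x₁ x₂) * κ)
  det-apex₁ n κ (a , b) (c , d) (e , f) =
    solve 8 (λ n κ a b c d e f → :det (:apex n κ (a , b) (c , d) (e , f)) (c , d)
                                 := n :* (:det (a , b) (c , d) :* :det (c , d) (e , f)
                                          :+ (:det (a , b) (c , d) :* :det (c , d) (e , f)) :* κ))
      refl n κ a b c d e f

  det-apex₂ : ∀ n κ x₀ x₁ x₂ → det (apex n κ x₀ x₁ x₂) x₂ ≡ n * (det x₁ x₂ * det x₀ x₂)
  det-apex₂ n κ (a , b) (c , d) (e , f) =
    solve 8 (λ n κ a b c d e f → :det (:apex n κ (a , b) (c , d) (e , f)) (e , f)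
                                 := n :* (:det (c , d) (e , f) :* :det (a , b) (e , f)))
      refl n κ a b c d e f

  det-apex₃ : ∀ n κ x₀ x₁ x₂ x₃ →
              det (apex n κ x₀ x₁ x₂) x₃ ≡ n * - (det x₃ x₀ * det x₁ x₂ + κ * (det x₀ x₁ * det x₂ x₃))
  det-apex₃ n κ (a , b) (c , d) (e , f) (g , h) =
    solve 10 (λ n κ a b c d e f g h → :det (:apex n κ (a , b) (c , d) (e , f)) (g , h)
                                      := n :* :- (:det (g , h) (a , b) :* :det (c , d) (e , f)
                                                  :+ κ :* (:det (a , b) (c , d) :* :det (e , f) (g , h))))
      refl n κ a b c d e f g h

  IndexTwo : Set
  IndexTwo = ∀ {x y} → NonUnit x → NonUnit y → InU (x * y)

  record ConeCondition (κ : Carrier) : Set where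
    field
      κ-unit              : InU κ
      1+κ-nonunit         : NonUnit (1# + κ)
      combination-nonunit : ∀ {a b} → InU a → InU b → InU (a - b) → NonUnit (b + κ * a)

  module _ (index-two : IndexTwo) {κ} (cone : ConeCondition κ) {x₀ x₁ x₂ x₃ : V2}
           (x₀x₁ : Unimodular x₀ x₁) (x₁x₂ : Unimodular x₁ x₂)
           (x₂x₃ : Unimodular x₂ x₃) (x₃x₀ : Unimodular x₃ x₀)
           (D₀₂∉U : NonUnit (det x₀ x₂)) (D₁₃∉U : NonUnit (det x₁ x₃)) where

    open ConeCondition cone

    private
      n = 1# + κ
      y = apex n κ x₀ x₁ x₂

      unimodular-via : ∀ {t} x → det y x ≡ n * t → NonUnit t → Unimodular y x
      unimodular-via _ eq t∉U = InU-resp (≈-reflexive (sym eq)) (index-two 1+κ-nonunit t∉U)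

    apex-unimodular : ∃ λ y → Unimodular y x₀ × Unimodular y x₁ × Unimodular y x₂ × Unimodular y x₃
    apex-unimodular = y ,
      unimodular-via x₀ (det-apex₀ n κ x₀ x₁ x₂) (InU-*-NonUnit (InU-* κ-unit x₀x₁) D₀₂∉U) ,
      unimodular-via x₁ (trans (det-apex₁ n κ x₀ x₁ x₂) (cong (n *_) (factor (det x₀ x₁ * det x₁ x₂))))
        (InU-*-NonUnit (InU-* x₀x₁ x₁x₂) 1+κ-nonunit) ,
      unimodular-via x₂ (det-apex₂ n κ x₀ x₁ x₂) (InU-*-NonUnit x₁x₂ D₀₂∉U) ,
      unimodular-via x₃ (det-apex₃ n κ x₀ x₁ x₂ x₃)
        (NonUnit-neg (combination-nonunit (InU-* x₀x₁ x₂x₃) (InU-* x₃x₀ x₁x₂) D₀₁D₂₃-D₃₀D₁₂∈U))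
      where
      factor : ∀ D → D + D * κ ≡ D * n
      factor D = sym (trans (distribˡ D 1# κ) (cong (_+ D * κ) (*-identityʳ D)))
      D₀₁D₂₃-D₃₀D₁₂∈U : InU (det x₀ x₁ * det x₂ x₃ - det x₃ x₀ * det x₁ x₂)
      D₀₁D₂₃-D₃₀D₁₂∈U = InU-resp (≈-reflexive (plücker x₀ x₁ x₂ x₃)) (index-two D₀₂∉U D₁₃∉U)

  module _ (classify : ∀ x → x ≈ 0# ⊎ InU x ⊎ NonUnit x) (index-two : IndexTwo)
           {κ} (cone : ConeCondition κ) where

    square-null : ∀ {x₀ x₁ x₂ x₃} →
                  Unimodular x₀ x₁ → Unimodular x₁ x₂ → Unimodular x₂ x₃ → Unimodular x₃ x₀ →
                  Homotopic (x₀ ∷ x₁ ∷ x₂ ∷ x₃ ∷ x₀ ∷ []) (x₀ ∷ [])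
    square-null {x₀} {x₁} {x₂} {x₃} x₀x₁ x₁x₂ x₂x₃ x₃x₀ with classify (det x₀ x₂) | classify (det x₁ x₃)
    ... | inj₁ D₀₂≈0 | _ =
      square-split₀₂ (simplex-mono (here ∼-refl ∷ there (here ∼-refl) ∷ here x₂∼x₀ ∷ []) (pair-simplex x₀x₁))
                     (simplex-mono (here (∼-sym x₂∼x₀) ∷ here ∼-refl ∷ there (here ∼-refl) ∷ [])
                                   (pair-simplex x₂x₃))
                     (unimodular-sym x₃x₀)
      where x₂∼x₀ = det≈0⇒∼ x₀x₁ D₀₂≈0 (unimodular-sym x₁x₂)
    ... | inj₂ (inj₁ x₀x₂) | _ =
      square-split₀₂ (triangle-simplex x₀x₁ x₀x₂ x₁x₂) (triangle-simplex x₀x₂ (unimodular-sym x₃x₀) x₂x₃)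
                     (unimodular-sym x₃x₀)
    ... | inj₂ (inj₂ _) | inj₁ D₁₃≈0 =
      square-split₁₃ (simplex-mono (here ∼-refl ∷ there (here ∼-refl) ∷ here x₃∼x₁ ∷ []) (pair-simplex x₁x₂))
                     (simplex-mono (there (here ∼-refl) ∷ there (here x₃∼x₁) ∷ here ∼-refl ∷ [])
                                   (pair-simplex x₀x₁))
                     x₀x₁
      where x₃∼x₁ = det≈0⇒∼ x₁x₂ D₁₃≈0 (unimodular-sym x₂x₃)
    ... | inj₂ (inj₂ _) | inj₂ (inj₁ x₁x₃) =
      square-split₁₃ (triangle-simplex x₁x₂ x₁x₃ x₂x₃) (triangle-simplex x₁x₃ (unimodular-sym x₀x₁) x₃x₀) x₀x₁
    ... | inj₂ (inj₂ D₀₂∉U) | inj₂ (inj₂ D₁₃∉U) =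
      square-cone x₀x₁ x₁x₂ x₂x₃ x₃x₀ (apex-unimodular index-two cone x₀x₁ x₁x₂ x₂x₃ x₃x₀ D₀₂∉U D₁₃∉U)

    loops4-null : Loops4Null
    loops4-null _ _ _ _ e₀₁ e₁₂ e₂₃ e₃₀ =
      square-null (edge-unimodular e₀₁) (edge-unimodular e₁₂) (edge-unimodular e₂₃) (edge-unimodular e₃₀)

  -- Finite models of R/(p)

  record FiniteModel : Set₁ where
    field
      Residue        : Set
      all?           : ∀ {P : Residue → Set} → Decidable P → Dec (∀ i → P i)
      _≟_            : DecidableEquality Residue
      reduce         : Carrier → Residue
      lift           : Residue → Carrier
      lift-reduce    : ∀ x → x ≈ lift (reduce x)
      lift-injective : ∀ {i j} → lift i ≈ lift j → i ≡ j

  record UnitList : Set where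
    field
      units           : List Carrier
      units-are-units : All IsUnit units
      units-complete  : ∀ {u} → IsUnit u → u ∈ units

  module Decision (model : FiniteModel) (unitList : UnitList) where
    open FiniteModel model
    open UnitList unitList

    _≈?_ : ∀ x y → Dec (x ≈ y)
    x ≈? y = map′ from to (reduce x ≟ reduce y)
      where
      from : reduce x ≡ reduce y → x ≈ y
      from eq = ≈-trans (lift-reduce x) (≈-trans (≈-reflexive (cong lift eq)) (≈-sym (lift-reduce y)))
      to : x ≈ y → reduce x ≡ reduce y
      to x≈y = lift-injective (≈-trans (≈-sym (lift-reduce x)) (≈-trans x≈y (lift-reduce y)))

    InU? : ∀ x → Dec (InU x)
    InU? x = map′ from to (Any.any? (x ≈?_) units)
      where
      from : Any (x ≈_) units → InU x
      from x≈unit = let (u-unit , x≈u) = All.lookupAny units-are-units x≈unit in _ , u-unit , x≈u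
      to : InU x → Any (x ≈_) units
      to (_ , u-unit , x≈u) = Any.map (λ { refl → x≈u }) (units-complete u-unit)

    NonUnit? : ∀ x → Dec (NonUnit x)
    NonUnit? x = ¬? (x ≈? 0#) ×-dec ¬? (InU? x)

    classify : ∀ x → x ≈ 0# ⊎ InU x ⊎ NonUnit x
    classify x with x ≈? 0# | InU? x
    ... | yes x≈0 | _       = inj₁ x≈0
    ... | no _    | yes x∈U = inj₂ (inj₁ x∈U)
    ... | no x≉0  | no x∉U  = inj₂ (inj₂ (x≉0 , x∉U))

    ∀²-by-lift : {P : Carrier → Carrier → Set} → (∀ {x x′ y y′} → x ≈ x′ → y ≈ y′ → P x y → P x′ y′) →
                 (∀ i j → P (lift i) (lift j)) → ∀ x y → P x y
    ∀²-by-lift resp P-lift x y =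
      resp (≈-sym (lift-reduce x)) (≈-sym (lift-reduce y)) (P-lift (reduce x) (reduce y))

    indexTwo? : Dec IndexTwo
    indexTwo? = map′ (λ h {x} {y} → ∀²-by-lift resp h x y) (λ h _ _ → h)
      (all? λ i → all? λ j → NonUnit? (lift i) →-dec (NonUnit? (lift j) →-dec InU? (lift i * lift j)))
      where
      resp : ∀ {x x′ y y′} → x ≈ x′ → y ≈ y′ →
             (NonUnit x → NonUnit y → InU (x * y)) → NonUnit x′ → NonUnit y′ → InU (x′ * y′)
      resp x≈x′ y≈y′ h x′∉U y′∉U =
        InU-resp (*-cong x≈x′ y≈y′) (h (NonUnit-resp (≈-sym x≈x′) x′∉U) (NonUnit-resp (≈-sym y≈y′) y′∉U))

    coneCondition? : ∀ κ → Dec (ConeCondition κ)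
    coneCondition? κ =
      map′ (λ (u , n , c) → record { κ-unit = u ; 1+κ-nonunit = n ; combination-nonunit = c })
           (λ c → κ-unit c , 1+κ-nonunit c , λ {a} {b} → combination-nonunit c {a} {b})
           (InU? κ ×-dec NonUnit? (1# + κ) ×-dec
            map′ (λ h {a} {b} → ∀²-by-lift resp h a b) (λ h _ _ → h)
              (all? λ i → all? λ j → InU? (lift i) →-dec (InU? (lift j) →-dec
                 (InU? (lift i - lift j) →-dec NonUnit? (lift j + κ * lift i)))))
      where
      open ConeCondition
      resp : ∀ {a a′ b b′} → a ≈ a′ → b ≈ b′ →
             (InU a → InU b → InU (a - b) → NonUnit (b + κ * a)) →
             InU a′ → InU b′ → InU (a′ - b′) → NonUnit (b′ + κ * a′)
      resp a≈a′ b≈b′ h a′∈U b′∈U a′-b′∈U =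
        NonUnit-resp (+-cong b≈b′ (*-cong ≈-refl a≈a′))
          (h (InU-resp (≈-sym a≈a′) a′∈U) (InU-resp (≈-sym b≈b′) b′∈U)
             (InU-resp (≈-sym (+-cong a≈a′ (-‿cong b≈b′))) a′-b′∈U))

    loops4-null-by-decision : ∀ κ → True indexTwo? → True (coneCondition? κ) → Loops4Null
    loops4-null-by-decision κ index-two cone = loops4-null classify (toWitness index-two) (toWitness cone)

ℤ² : Set
ℤ² = ℤ × ℤ

module ℤ²-Ring (_*_ : Op₂ ℤ²) where
  private
    _⊕_ : Op₂ ℤ²
    (a , b) ⊕ (c , d) = a ℤ.+ c , b ℤ.+ d

    ⊖_ : Op₁ ℤ²
    ⊖ (a , b) = ℤ.- a , ℤ.- b

    +-isAbelianGroup : IsAbelianGroup _≡_ _⊕_ (+ 0 , + 0) ⊖_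
    +-isAbelianGroup = record
      { isGroup = record
        { isMonoid = record
          { isSemigroup = record
            { isMagma = record { isEquivalence = isEquivalence ; ∙-cong = cong₂ _⊕_ }
            ; assoc = λ (a , b) (c , d) (e , f) → cong₂ _,_ (ℤ.+-assoc a c e) (ℤ.+-assoc b d f) }
          ; identity = (λ (a , b) → cong₂ _,_ (ℤ.+-identityˡ a) (ℤ.+-identityˡ b))
                     , (λ (a , b) → cong₂ _,_ (ℤ.+-identityʳ a) (ℤ.+-identityʳ b)) }
        ; inverse = (λ (a , b) → cong₂ _,_ (ℤ.+-inverseˡ a) (ℤ.+-inverseˡ b))
                  , (λ (a , b) → cong₂ _,_ (ℤ.+-inverseʳ a) (ℤ.+-inverseʳ b))
        ; ⁻¹-cong = cong ⊖_ }
      ; comm = λ (a , b) (c , d) → cong₂ _,_ (ℤ.+-comm a c) (ℤ.+-comm b d) }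

  ops : RingOps
  ops = record { Carrier = ℤ² ; _+_ = _⊕_ ; _*_ = _*_ ; -_ = ⊖_ ; 0# = + 0 , + 0 ; 1# = + 1 , + 0 }

  laws : Associative _≡_ _*_ → Commutative _≡_ _*_ → LeftIdentity _≡_ (+ 1 , + 0) _*_ →
         _DistributesOverˡ_ _≡_ _*_ _⊕_ → (∀ m n → (m ℤ.* n , + 0) ≡ (m , + 0) * (n , + 0)) →
         RingLaws ops
  laws *-assoc *-comm *-identityˡ *-distribˡ-+ *-homo = record
    { isCommutativeRing = record
      { isRing = record
        { +-isAbelianGroup = +-isAbelianGroup
        ; *-cong = cong₂ _*_
        ; *-assoc = *-assoc
        ; *-identity = comm∧idˡ⇒id *-comm *-identityˡ
        ; distrib = *-distribˡ-+ , comm∧distrˡ⇒distrʳ *-comm *-distribˡ-+ }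
      ; *-comm = *-comm }
    ; fromℤ = record
      { ⟦_⟧ = λ m → m , + 0 ; +-homo = λ _ _ → refl ; *-homo = *-homo
      ; -‿homo = λ _ → refl ; 0-homo = refl ; 1-homo = refl } }

ℤ[ι]-laws : RingLaws ℤ[ι]
ℤ[ι]-laws = ℤ²-Ring.laws _*_ assoc comm identityˡ distribˡ homo
  where
  open RingOps ℤ[ι]
  assoc : Associative _≡_ _*_
  assoc (a , b) (c , d) (e , f) = cong₂ _,_ (re a b c d e f) (im a b c d e f)
    where
    re : ∀ a b c d e f → (a ℤ.* c ℤ.- b ℤ.* d) ℤ.* e ℤ.- (a ℤ.* d ℤ.+ b ℤ.* c) ℤ.* f
                       ≡ a ℤ.* (c ℤ.* e ℤ.- d ℤ.* f) ℤ.- b ℤ.* (c ℤ.* f ℤ.+ d ℤ.* e)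
    re = solve-∀
    im : ∀ a b c d e f → (a ℤ.* c ℤ.- b ℤ.* d) ℤ.* f ℤ.+ (a ℤ.* d ℤ.+ b ℤ.* c) ℤ.* e
                       ≡ a ℤ.* (c ℤ.* f ℤ.+ d ℤ.* e) ℤ.+ b ℤ.* (c ℤ.* e ℤ.- d ℤ.* f)
    im = solve-∀
  comm : Commutative _≡_ _*_
  comm (a , b) (c , d) = cong₂ _,_ (re a b c d) (im a b c d)
    where
    re : ∀ a b c d → a ℤ.* c ℤ.- b ℤ.* d ≡ c ℤ.* a ℤ.- d ℤ.* b
    re = solve-∀
    im : ∀ a b c d → a ℤ.* d ℤ.+ b ℤ.* c ≡ c ℤ.* b ℤ.+ d ℤ.* a
    im = solve-∀
  identityˡ : LeftIdentity _≡_ 1# _*_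
  identityˡ (a , b) = cong₂ _,_ (re a b) (im a b)
    where
    re : ∀ a b → + 1 ℤ.* a ℤ.- + 0 ℤ.* b ≡ a
    re = solve-∀
    im : ∀ a b → + 1 ℤ.* b ℤ.+ + 0 ℤ.* a ≡ b
    im = solve-∀
  distribˡ : _DistributesOverˡ_ _≡_ _*_ _+_
  distribˡ (a , b) (c , d) (e , f) = cong₂ _,_ (re a b c d e f) (im a b c d e f)
    where
    re : ∀ a b c d e f → a ℤ.* (c ℤ.+ e) ℤ.- b ℤ.* (d ℤ.+ f) ≡ (a ℤ.* c ℤ.- b ℤ.* d) ℤ.+ (a ℤ.* e ℤ.- b ℤ.* f)
    re = solve-∀
    im : ∀ a b c d e f → a ℤ.* (d ℤ.+ f) ℤ.+ b ℤ.* (c ℤ.+ e) ≡ (a ℤ.* d ℤ.+ b ℤ.* c) ℤ.+ (a ℤ.* f ℤ.+ b ℤ.* e)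
    im = solve-∀
  homo : ∀ m n → (m ℤ.* n , + 0) ≡ (m , + 0) * (n , + 0)
  homo m n = cong₂ _,_ (re m n) (im m n)
    where
    re : ∀ m n → m ℤ.* n ≡ m ℤ.* n ℤ.- + 0 ℤ.* + 0
    re = solve-∀
    im : ∀ m n → + 0 ≡ m ℤ.* + 0 ℤ.+ + 0 ℤ.* n
    im = solve-∀

ℤ[ω]-laws : RingLaws ℤ[ω]
ℤ[ω]-laws = ℤ²-Ring.laws _*_ assoc comm identityˡ distribˡ homo
  where
  open RingOps ℤ[ω]
  assoc : Associative _≡_ _*_
  assoc (a , b) (c , d) (e , f) = cong₂ _,_ (re a b c d e f) (im a b c d e f)
    where
    re : ∀ a b c d e f → (a ℤ.* c ℤ.- b ℤ.* d) ℤ.* e ℤ.- (a ℤ.* d ℤ.+ b ℤ.* c ℤ.- b ℤ.* d) ℤ.* f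
                       ≡ a ℤ.* (c ℤ.* e ℤ.- d ℤ.* f) ℤ.- b ℤ.* (c ℤ.* f ℤ.+ d ℤ.* e ℤ.- d ℤ.* f)
    re = solve-∀
    im : ∀ a b c d e f → (a ℤ.* c ℤ.- b ℤ.* d) ℤ.* f ℤ.+ (a ℤ.* d ℤ.+ b ℤ.* c ℤ.- b ℤ.* d) ℤ.* e
                           ℤ.- (a ℤ.* d ℤ.+ b ℤ.* c ℤ.- b ℤ.* d) ℤ.* f
                       ≡ a ℤ.* (c ℤ.* f ℤ.+ d ℤ.* e ℤ.- d ℤ.* f) ℤ.+ b ℤ.* (c ℤ.* e ℤ.- d ℤ.* f)
                           ℤ.- b ℤ.* (c ℤ.* f ℤ.+ d ℤ.* e ℤ.- d ℤ.* f)
    im = solve-∀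
  comm : Commutative _≡_ _*_
  comm (a , b) (c , d) = cong₂ _,_ (re a b c d) (im a b c d)
    where
    re : ∀ a b c d → a ℤ.* c ℤ.- b ℤ.* d ≡ c ℤ.* a ℤ.- d ℤ.* b
    re = solve-∀
    im : ∀ a b c d → a ℤ.* d ℤ.+ b ℤ.* c ℤ.- b ℤ.* d ≡ c ℤ.* b ℤ.+ d ℤ.* a ℤ.- d ℤ.* b
    im = solve-∀
  identityˡ : LeftIdentity _≡_ 1# _*_
  identityˡ (a , b) = cong₂ _,_ (re a b) (im a b)
    where
    re : ∀ a b → + 1 ℤ.* a ℤ.- + 0 ℤ.* b ≡ a
    re = solve-∀
    im : ∀ a b → + 1 ℤ.* b ℤ.+ + 0 ℤ.* a ℤ.- + 0 ℤ.* b ≡ b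
    im = solve-∀
  distribˡ : _DistributesOverˡ_ _≡_ _*_ _+_
  distribˡ (a , b) (c , d) (e , f) = cong₂ _,_ (re a b c d e f) (im a b c d e f)
    where
    re : ∀ a b c d e f → a ℤ.* (c ℤ.+ e) ℤ.- b ℤ.* (d ℤ.+ f) ≡ (a ℤ.* c ℤ.- b ℤ.* d) ℤ.+ (a ℤ.* e ℤ.- b ℤ.* f)
    re = solve-∀
    im : ∀ a b c d e f → a ℤ.* (d ℤ.+ f) ℤ.+ b ℤ.* (c ℤ.+ e) ℤ.- b ℤ.* (d ℤ.+ f)
                       ≡ (a ℤ.* d ℤ.+ b ℤ.* c ℤ.- b ℤ.* d) ℤ.+ (a ℤ.* f ℤ.+ b ℤ.* e ℤ.- b ℤ.* f)
    im = solve-∀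
  homo : ∀ m n → (m ℤ.* n , + 0) ≡ (m , + 0) * (n , + 0)
  homo m n = cong₂ _,_ (re m n) (im m n)
    where
    re : ∀ m n → m ℤ.* n ≡ m ℤ.* n ℤ.- + 0 ℤ.* + 0
    re = solve-∀
    im : ∀ m n → + 0 ≡ m ℤ.* + 0 ℤ.+ + 0 ℤ.* n ℤ.- + 0 ℤ.* + 0
    im = solve-∀

-- Units and residue fields of ℤ[ι] and ℤ[ω]

∣_∣² : ℤ → ℕ
∣ a ∣² = ∣ a ∣ ℕ.* ∣ a ∣

square-abs : ∀ a → a ℤ.* a ≡ + ∣ a ∣²
square-abs (+ m)    = ℤ.+◃n≡+n (m ℕ.* m)
square-abs -[1+ m ] = ℤ.+◃n≡+n (suc m ℕ.* suc m)

[2+m]²≰2 : ∀ m → ¬ suc (suc m) ℕ.* suc (suc m) ℕ.≤ 2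
[2+m]²≰2 m h with ℕ.≤-trans (ℕ.*-mono-≤ (s≤s (s≤s (z≤n {m}))) (s≤s (s≤s (z≤n {m})))) h
... | s≤s (s≤s ())

square≤2⇒small : ∀ a → ∣ a ∣² ℕ.≤ 2 → a ≡ + 0 ⊎ a ≡ + 1 ⊎ a ≡ -[1+ 0 ]
square≤2⇒small (+ zero)        _    = inj₁ refl
square≤2⇒small (+ suc zero)    _    = inj₂ (inj₁ refl)
square≤2⇒small -[1+ zero ]     _    = inj₂ (inj₂ refl)
square≤2⇒small (+ suc (suc m)) a²≤2 = ⊥-elim ([2+m]²≰2 m a²≤2)
square≤2⇒small -[1+ suc m ]    a²≤2 = ⊥-elim ([2+m]²≰2 m a²≤2)

unit⇒∣norm∣≡1 : (_*_ : Op₂ ℤ²) (norm : ℤ² → ℤ) → (∀ x y → norm (x * y) ≡ norm x ℤ.* norm y) →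
                norm (+ 1 , + 0) ≡ + 1 → ∀ x y → x * y ≡ (+ 1 , + 0) → ∣ norm x ∣ ≡ 1
unit⇒∣norm∣≡1 _*_ norm norm-* norm-1 x y xy≡1 = ℕ.m*n≡1⇒m≡1 _ ∣ norm y ∣ (begin
  ∣ norm x ∣ ℕ.* ∣ norm y ∣ ≡⟨ ℤ.abs-* (norm x) (norm y) ⟨
  ∣ norm x ℤ.* norm y ∣     ≡⟨ cong ∣_∣ (norm-* x y) ⟨
  ∣ norm (x * y) ∣          ≡⟨ cong (∣_∣ ∘ norm) xy≡1 ⟩
  ∣ norm (+ 1 , + 0) ∣      ≡⟨ cong ∣_∣ norm-1 ⟩
  1                         ∎)
  where open ≡-Reasoning

module Residues (q : ℕ) .{{_ : ℕ.NonZero q}} where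

  residue : ℤ → Fin q
  residue z = Fin.fromℕ< (ℤ.n%ℕd<d z q)

  residue-spec : ∀ z → z ≡ + toℕ (residue z) ℤ.+ (z ℤ./ℕ q) ℤ.* + q
  residue-spec z =
    trans (ℤ.a≡a%ℕn+[a/ℕn]*n z q) (cong (λ r → + r ℤ.+ (z ℤ./ℕ q) ℤ.* + q) (sym (Fin.toℕ-fromℕ< _)))

  private
    ≡-by-multiple : ∀ {a b} m → + a ℤ.- + b ≡ + m ℤ.* + q → a ℕ.< q → b ℕ.< q → a ≡ b
    ≡-by-multiple {a} {b} m a-b≡mq a<q b<q = begin
      a                     ≡⟨ ℕ.m<n⇒m%n≡m a<q ⟨
      a ℕ.% q               ≡⟨ cong (ℕ._% q) a≡b+mq ⟩
      (b ℕ.+ m ℕ.* q) ℕ.% q ≡⟨ ℕ.[m+kn]%n≡m%n b m q ⟩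
      b ℕ.% q               ≡⟨ ℕ.m<n⇒m%n≡m b<q ⟩
      b                     ∎
      where
      open ≡-Reasoning
      a≡b+[a-b] : ∀ a b → a ≡ b ℤ.+ (a ℤ.- b)
      a≡b+[a-b] = solve-∀
      a≡b+mq : a ≡ b ℕ.+ m ℕ.* q
      a≡b+mq = ℤ.+-injective (trans (a≡b+[a-b] (+ a) (+ b))
                                    (cong (ℤ._+_ (+ b)) (trans a-b≡mq (sym (ℤ.pos-* m q)))))

  residue-injective : ∀ {i j : Fin q} t → + toℕ i ℤ.- + toℕ j ≡ t ℤ.* + q → i ≡ j
  residue-injective {i} {j} (+ m) i-j≡mq =
    Fin.toℕ-injective (≡-by-multiple m i-j≡mq (Fin.toℕ<n i) (Fin.toℕ<n j))
  residue-injective {i} {j} -[1+ m ] i-j≡-mq =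
    sym (Fin.toℕ-injective (≡-by-multiple (suc m) j-i≡mq (Fin.toℕ<n j) (Fin.toℕ<n i)))
    where
    swap : ∀ a b → b ℤ.- a ≡ ℤ.- (a ℤ.- b)
    swap = solve-∀
    j-i≡mq : + toℕ j ℤ.- + toℕ i ≡ + suc m ℤ.* + q
    j-i≡mq = trans (swap (+ toℕ i) (+ toℕ j)) (trans (cong ℤ.-_ i-j≡-mq) (ℤ.neg-distribˡ-* -[1+ m ] (+ q)))

module Gaussian where
  open RingOps ℤ[ι]
  open BDA-Properties ℤ[ι] ℤ[ι]-laws (prime gauss3) using (UnitList; FiniteModel)

  norm : ℤ² → ℤ
  norm (a , b) = a ℤ.* a ℤ.+ b ℤ.* b

  norm-* : ∀ x y → norm (x * y) ≡ norm x ℤ.* norm y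
  norm-* (a , b) (c , d) = identity a b c d
    where
    identity : ∀ a b c d → let e = a ℤ.* c ℤ.- b ℤ.* d ; f = a ℤ.* d ℤ.+ b ℤ.* c in
                           e ℤ.* e ℤ.+ f ℤ.* f ≡ (a ℤ.* a ℤ.+ b ℤ.* b) ℤ.* (c ℤ.* c ℤ.+ d ℤ.* d)
    identity = solve-∀

  units : List ℤ²
  units = (+ 1 , + 0) ∷ (-[1+ 0 ] , + 0) ∷ (+ 0 , + 1) ∷ (+ 0 , -[1+ 0 ]) ∷ []

  unit-classification : ∀ {x y} → x * y ≡ 1# → x ∈ units
  unit-classification {a , b} {y} xy≡1 =
    enumerate (square≤2⇒small a (ℕ.≤-trans (ℕ.m≤m+n _ _) a²+b²≤2))
              (square≤2⇒small b (ℕ.≤-trans (ℕ.m≤n+m _ _) a²+b²≤2)) a²+b²≡1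
    where
    a²+b²≡1 : ∣ a ∣² ℕ.+ ∣ b ∣² ≡ 1
    a²+b²≡1 = trans (cong ∣_∣ (sym (cong₂ ℤ._+_ (square-abs a) (square-abs b))))
                    (unit⇒∣norm∣≡1 _*_ norm norm-* refl (a , b) y xy≡1)
    a²+b²≤2 : ∣ a ∣² ℕ.+ ∣ b ∣² ℕ.≤ 2
    a²+b²≤2 = subst (ℕ._≤ 2) (sym a²+b²≡1) (s≤s z≤n)
    enumerate : ∀ {a b} → a ≡ + 0 ⊎ a ≡ + 1 ⊎ a ≡ -[1+ 0 ] → b ≡ + 0 ⊎ b ≡ + 1 ⊎ b ≡ -[1+ 0 ] →
                ∣ a ∣² ℕ.+ ∣ b ∣² ≡ 1 → (a , b) ∈ units
    enumerate (inj₁ refl)        (inj₁ refl)        ()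
    enumerate (inj₁ refl)        (inj₂ (inj₁ refl)) _  = there (there (here refl))
    enumerate (inj₁ refl)        (inj₂ (inj₂ refl)) _  = there (there (there (here refl)))
    enumerate (inj₂ (inj₁ refl)) (inj₁ refl)        _  = here refl
    enumerate (inj₂ (inj₁ refl)) (inj₂ (inj₁ refl)) ()
    enumerate (inj₂ (inj₁ refl)) (inj₂ (inj₂ refl)) ()
    enumerate (inj₂ (inj₂ refl)) (inj₁ refl)        _  = there (here refl)
    enumerate (inj₂ (inj₂ refl)) (inj₂ (inj₁ refl)) ()
    enumerate (inj₂ (inj₂ refl)) (inj₂ (inj₂ refl)) ()

  unitList : UnitList
  unitList = record
    { units = units
    ; units-are-units = ((+ 1 , + 0) , refl) ∷ ((-[1+ 0 ] , + 0) , refl) ∷ ((+ 0 , -[1+ 0 ]) , refl) ∷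
                        ((+ 0 , + 1) , refl) ∷ []
    ; units-complete = λ (_ , xy≡1) → unit-classification xy≡1
    }

  model : FiniteModel
  model = record
    { Residue = Fin 3 × Fin 3
    ; all? = λ P? → map′ (λ h (i , j) → h i j) (λ h i j → h (i , j))
                         (Fin.all? λ i → Fin.all? λ j → P? (i , j))
    ; _≟_ = ≡-dec Fin._≟_ Fin._≟_
    ; reduce = λ (a , b) → residue a , residue b
    ; lift = λ (i , j) → + toℕ i , + toℕ j
    ; lift-reduce = λ (a , b) → (a ℤ./ℕ 3 , b ℤ./ℕ 3) ,
        cong₂ _,_ (re _ (a ℤ./ℕ 3) (b ℤ./ℕ 3) (residue-spec a)) (im _ (a ℤ./ℕ 3) (b ℤ./ℕ 3) (residue-spec b))
    ; lift-injective = λ ((c , c′) , eq) → cong₂ _,_ (residue-injective c (trans (cong proj₁ eq) (re′ c c′)))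
                                                     (residue-injective c′ (trans (cong proj₂ eq) (im′ c c′)))
    }
    where
    open Residues 3
    re : ∀ {a} r k l → a ≡ + r ℤ.+ k ℤ.* + 3 → a ℤ.- + r ≡ k ℤ.* + 3 ℤ.- l ℤ.* + 0
    re r k l refl = identity (+ r) k l
      where
      identity : ∀ r k l → r ℤ.+ k ℤ.* + 3 ℤ.- r ≡ k ℤ.* + 3 ℤ.- l ℤ.* + 0
      identity = solve-∀
    im : ∀ {b} r k l → b ≡ + r ℤ.+ l ℤ.* + 3 → b ℤ.- + r ≡ k ℤ.* + 0 ℤ.+ l ℤ.* + 3
    im r k l refl = identity (+ r) k l
      where
      identity : ∀ r k l → r ℤ.+ l ℤ.* + 3 ℤ.- r ≡ k ℤ.* + 0 ℤ.+ l ℤ.* + 3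
      identity = solve-∀
    re′ : ∀ c c′ → c ℤ.* + 3 ℤ.- c′ ℤ.* + 0 ≡ c ℤ.* + 3
    re′ = solve-∀
    im′ : ∀ c c′ → c ℤ.* + 0 ℤ.+ c′ ℤ.* + 3 ≡ c′ ℤ.* + 3
    im′ = solve-∀

module Eisenstein where
  open RingOps ℤ[ω]

  norm : ℤ² → ℤ
  norm (a , b) = a ℤ.* a ℤ.- a ℤ.* b ℤ.+ b ℤ.* b

  norm-* : ∀ x y → norm (x * y) ≡ norm x ℤ.* norm y
  norm-* (a , b) (c , d) = identity a b c d
    where
    identity : ∀ a b c d → let e = a ℤ.* c ℤ.- b ℤ.* d ; f = a ℤ.* d ℤ.+ b ℤ.* c ℤ.- b ℤ.* d in
                           e ℤ.* e ℤ.- e ℤ.* f ℤ.+ f ℤ.* f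
                           ≡ (a ℤ.* a ℤ.- a ℤ.* b ℤ.+ b ℤ.* b) ℤ.* (c ℤ.* c ℤ.- c ℤ.* d ℤ.+ d ℤ.* d)
    identity = solve-∀

  twice-norm : ∀ a b → + 2 ℤ.* norm (a , b) ≡ + (∣ a ∣² ℕ.+ ∣ b ∣² ℕ.+ ∣ a ℤ.- b ∣²)
  twice-norm a b =
    trans (identity a b) (cong₂ ℤ._+_ (cong₂ ℤ._+_ (square-abs a) (square-abs b)) (square-abs (a ℤ.- b)))
    where
    identity : ∀ a b → + 2 ℤ.* (a ℤ.* a ℤ.- a ℤ.* b ℤ.+ b ℤ.* b)
                     ≡ a ℤ.* a ℤ.+ b ℤ.* b ℤ.+ (a ℤ.- b) ℤ.* (a ℤ.- b)
    identity = solve-∀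

  ∣z∣≡1⇒2z≡s⇒s≡2 : ∀ {z s} → ∣ z ∣ ≡ 1 → + 2 ℤ.* z ≡ + s → s ≡ 2
  ∣z∣≡1⇒2z≡s⇒s≡2 {+ 1}       _ 2≡s = sym (ℤ.+-injective 2≡s)
  ∣z∣≡1⇒2z≡s⇒s≡2 { -[1+ 0 ]} _ ()

  units : List ℤ²
  units = (+ 1 , + 0) ∷ (-[1+ 0 ] , + 0) ∷ (+ 0 , + 1) ∷ (+ 0 , -[1+ 0 ]) ∷
          (+ 1 , + 1) ∷ (-[1+ 0 ] , -[1+ 0 ]) ∷ []

  unit-classification : ∀ {x y} → x * y ≡ 1# → x ∈ units
  unit-classification {a , b} {y} xy≡1 =
    enumerate (square≤2⇒small a (ℕ.≤-trans (ℕ.≤-trans (ℕ.m≤m+n _ _) (ℕ.m≤m+n _ _)) S≤2))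
              (square≤2⇒small b (ℕ.≤-trans (ℕ.≤-trans (ℕ.m≤n+m _ ∣ a ∣²) (ℕ.m≤m+n _ _)) S≤2)) S≡2
    where
    S≡2 : ∣ a ∣² ℕ.+ ∣ b ∣² ℕ.+ ∣ a ℤ.- b ∣² ≡ 2
    S≡2 = ∣z∣≡1⇒2z≡s⇒s≡2 (unit⇒∣norm∣≡1 _*_ norm norm-* refl (a , b) y xy≡1) (twice-norm a b)
    S≤2 : ∣ a ∣² ℕ.+ ∣ b ∣² ℕ.+ ∣ a ℤ.- b ∣² ℕ.≤ 2
    S≤2 = subst (ℕ._≤ 2) (sym S≡2) ℕ.≤-refl
    enumerate : ∀ {a b} → a ≡ + 0 ⊎ a ≡ + 1 ⊎ a ≡ -[1+ 0 ] → b ≡ + 0 ⊎ b ≡ + 1 ⊎ b ≡ -[1+ 0 ] →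
                ∣ a ∣² ℕ.+ ∣ b ∣² ℕ.+ ∣ a ℤ.- b ∣² ≡ 2 → (a , b) ∈ units
    enumerate (inj₁ refl)        (inj₁ refl)        ()
    enumerate (inj₁ refl)        (inj₂ (inj₁ refl)) _  = there (there (here refl))
    enumerate (inj₁ refl)        (inj₂ (inj₂ refl)) _  = there (there (there (here refl)))
    enumerate (inj₂ (inj₁ refl)) (inj₁ refl)        _  = here refl
    enumerate (inj₂ (inj₁ refl)) (inj₂ (inj₁ refl)) _  = there (there (there (there (here refl))))
    enumerate (inj₂ (inj₁ refl)) (inj₂ (inj₂ refl)) ()
    enumerate (inj₂ (inj₂ refl)) (inj₁ refl)        _  = there (here refl)
    enumerate (inj₂ (inj₂ refl)) (inj₂ (inj₁ refl)) ()
    enumerate (inj₂ (inj₂ refl)) (inj₂ (inj₂ refl)) _  = there (there (there (there (there (here refl)))))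

  unitList : ∀ p → BDA-Properties.UnitList ℤ[ω] ℤ[ω]-laws p
  unitList p = record
    { units = units
    ; units-are-units = ((+ 1 , + 0) , refl) ∷ ((-[1+ 0 ] , + 0) , refl) ∷ ((-[1+ 0 ] , -[1+ 0 ]) , refl) ∷
                        ((+ 1 , + 1) , refl) ∷ ((+ 0 , -[1+ 0 ]) , refl) ∷ ((+ 0 , + 1) , refl) ∷ []
    ; units-complete = λ (_ , xy≡1) → unit-classification xy≡1
    }

  -- ℤ[ω]/(4ω + 1) and ℤ[ω]/(4ω + 3) are 𝔽₁₃ via ω ↦ 3 and ω ↦ 9 respectively; the witnesses in
  -- lift-reduce are (a − k + bω)·p̄/13, where k ∈ 𝔽₁₃ is the class of a + bω.
  module _ where
    open Residues 13

    private
      drop-vanishing-term : ∀ {x e} t k → x ≡ t ℤ.* + 13 ℤ.- k ℤ.* e → + 0 ≡ e → x ≡ t ℤ.* + 13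
      drop-vanishing-term t k refl refl = identity t k
        where
        identity : ∀ t k → t ℤ.* + 13 ℤ.- k ℤ.* + 0 ≡ t ℤ.* + 13
        identity = solve-∀

    model-4ω+1 : BDA-Properties.FiniteModel ℤ[ω] ℤ[ω]-laws (prime eis4ω+1)
    model-4ω+1 = record
      { Residue = Fin 13 ; all? = Fin.all? ; _≟_ = Fin._≟_
      ; reduce = λ (a , b) → residue (a ℤ.+ + 3 ℤ.* b)
      ; lift = λ k → + toℕ k , + 0
      ; lift-reduce = λ (a , b) → let m = (a ℤ.+ + 3 ℤ.* b) ℤ./ℕ 13 in
          (b ℤ.- + 3 ℤ.* m , b ℤ.- + 4 ℤ.* m) , cong₂ _,_ (re a b _ m (residue-spec _)) (im b m)
      ; lift-injective = λ ((c , c′) , eq) → residue-injective (c ℤ.- c′)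
          (drop-vanishing-term (c ℤ.- c′) (+ 3) (trans (cong proj₁ eq) (identity c c′)) (cong proj₂ eq))
      }
      where
      re : ∀ a b k m → a ℤ.+ + 3 ℤ.* b ≡ k ℤ.+ m ℤ.* + 13 →
           a ℤ.- k ≡ (b ℤ.- + 3 ℤ.* m) ℤ.* + 1 ℤ.- (b ℤ.- + 4 ℤ.* m) ℤ.* + 4
      re a b k m eq = trans (shift a b k) (trans (cong (λ t → t ℤ.- k ℤ.- + 3 ℤ.* b) eq) (expand b k m))
        where
        shift : ∀ a b k → a ℤ.- k ≡ a ℤ.+ + 3 ℤ.* b ℤ.- k ℤ.- + 3 ℤ.* b
        shift = solve-∀
        expand : ∀ b k m → k ℤ.+ m ℤ.* + 13 ℤ.- k ℤ.- + 3 ℤ.* b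
                         ≡ (b ℤ.- + 3 ℤ.* m) ℤ.* + 1 ℤ.- (b ℤ.- + 4 ℤ.* m) ℤ.* + 4
        expand = solve-∀
      im : ∀ b m → b ℤ.- + 0
                 ≡ (b ℤ.- + 3 ℤ.* m) ℤ.* + 4 ℤ.+ (b ℤ.- + 4 ℤ.* m) ℤ.* + 1 ℤ.- (b ℤ.- + 4 ℤ.* m) ℤ.* + 4
      im = solve-∀
      identity : ∀ c c′ → c ℤ.* + 1 ℤ.- c′ ℤ.* + 4
                          ≡ (c ℤ.- c′) ℤ.* + 13 ℤ.- + 3 ℤ.* (c ℤ.* + 4 ℤ.+ c′ ℤ.* + 1 ℤ.- c′ ℤ.* + 4)
      identity = solve-∀

    model-4ω+3 : BDA-Properties.FiniteModel ℤ[ω] ℤ[ω]-laws (prime eis4ω+3)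
    model-4ω+3 = record
      { Residue = Fin 13 ; all? = Fin.all? ; _≟_ = Fin._≟_
      ; reduce = λ (a , b) → residue (a ℤ.+ + 9 ℤ.* b)
      ; lift = λ k → + toℕ k , + 0
      ; lift-reduce = λ (a , b) → let m = (a ℤ.+ + 9 ℤ.* b) ℤ./ℕ 13 in
          (b ℤ.- m , + 3 ℤ.* b ℤ.- + 4 ℤ.* m) , cong₂ _,_ (re a b _ m (residue-spec _)) (im b m)
      ; lift-injective = λ ((c , c′) , eq) → residue-injective (+ 3 ℤ.* c ℤ.- c′)
          (drop-vanishing-term (+ 3 ℤ.* c ℤ.- c′) (+ 9) (trans (cong proj₁ eq) (identity c c′))
                               (cong proj₂ eq))
      }
      where
      re : ∀ a b k m → a ℤ.+ + 9 ℤ.* b ≡ k ℤ.+ m ℤ.* + 13 →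
           a ℤ.- k ≡ (b ℤ.- m) ℤ.* + 3 ℤ.- (+ 3 ℤ.* b ℤ.- + 4 ℤ.* m) ℤ.* + 4
      re a b k m eq = trans (shift a b k) (trans (cong (λ t → t ℤ.- k ℤ.- + 9 ℤ.* b) eq) (expand b k m))
        where
        shift : ∀ a b k → a ℤ.- k ≡ a ℤ.+ + 9 ℤ.* b ℤ.- k ℤ.- + 9 ℤ.* b
        shift = solve-∀
        expand : ∀ b k m → k ℤ.+ m ℤ.* + 13 ℤ.- k ℤ.- + 9 ℤ.* b
                         ≡ (b ℤ.- m) ℤ.* + 3 ℤ.- (+ 3 ℤ.* b ℤ.- + 4 ℤ.* m) ℤ.* + 4
        expand = solve-∀
      im : ∀ b m → b ℤ.- + 0
                 ≡ (b ℤ.- m) ℤ.* + 4 ℤ.+ (+ 3 ℤ.* b ℤ.- + 4 ℤ.* m) ℤ.* + 3 ℤ.- (+ 3 ℤ.* b ℤ.- + 4 ℤ.* m) ℤ.* + 4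
      im = solve-∀
      identity : ∀ c c′ → c ℤ.* + 3 ℤ.- c′ ℤ.* + 4
                          ≡ (+ 3 ℤ.* c ℤ.- c′) ℤ.* + 13 ℤ.- + 9 ℤ.* (c ℤ.* + 4 ℤ.+ c′ ℤ.* + 3 ℤ.- c′ ℤ.* + 4)
      identity = solve-∀

lemma2p48 : (c : Case) → BDA.Loops4Null (ring c) (prime c)
lemma2p48 gauss3  = BDA-Properties.Decision.loops4-null-by-decision ℤ[ι] ℤ[ι]-laws (prime gauss3)
                      Gaussian.model Gaussian.unitList (+ 0 , + 1) _ _
lemma2p48 eis4ω+1 = BDA-Properties.Decision.loops4-null-by-decision ℤ[ω] ℤ[ω]-laws (prime eis4ω+1)
                      Eisenstein.model-4ω+1 (Eisenstein.unitList _) (+ 1 , + 0) _ _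
lemma2p48 eis4ω+3 = BDA-Properties.Decision.loops4-null-by-decision ℤ[ω] ℤ[ω]-laws (prime eis4ω+3)
                      Eisenstein.model-4ω+3 (Eisenstein.unitList _) (+ 1 , + 0) _ _
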